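{- Let $a\ge 1$ and let $d$ be an odd integer with $d<a$. Then $U=\{(a,0),(0,0)\}\cup\{(c,d)\in\mathcal{B}\mid \max\{c,c+d\}<a\}$ is avoidable in $\mathcal{B}$.
   Context: The bicyclic inverse semigroup is $\mathcal{B}=\{(a,b)\in\mathbb{Z}\times\mathbb{Z}\mid a\ge 0,\ a+b\ge 0\}$ with multiplication $(a,b)(c,d)=(\max\{c+d,a\}-d,\ b+d)$. A subset $U\subseteq\mathcal{B}$ is avoidable if $\mathcal{B}$ can be partitioned into two sets $A$ and $B$ such that no element of $U$ is a product $st$ of two distinct elements $s\ne t$ both in $A$ or both in $B$. -}

module Defs where

open import Data.Integer using (ℤ; +_; _+_; _-_; _*_; _≤_; _<_; _⊔_)
open import Data.Product using (_×_; _,_; Σ; ∃; proj₁; proj₂)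
open import Data.Sum using (_⊎_)
open import Data.Bool using (Bool)
open import Relation.Binary.PropositionalEquality using (_≡_)
open import Relation.Nullary using (¬_)

-- The bicyclic inverse semigroup: pairs (a,b) of integers with a ≥ 0 and a + b ≥ 0.
InB : ℤ × ℤ → Set
InB (a , b) = (+ 0 ≤ a) × (+ 0 ≤ a + b)

_·_ : ℤ × ℤ → ℤ × ℤ → ℤ × ℤ
(a , b) · (c , d) = (((c + d) ⊔ a) - d , b + d)

Odd : ℤ → Set
Odd d = ∃ λ k → d ≡ + 2 * k + + 1

-- A subset U of B (given as a predicate on pairs) is avoidable if B can be
-- partitioned into two sets (colour classes of χ) such that no element of U is
-- a product s t of two distinct elements s ≠ t of B of the same colour.
Avoidable : (ℤ × ℤ → Set) → Set
Avoidable U =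
  Σ (ℤ × ℤ → Bool) λ χ →
    ∀ s t → InB s → InB t → ¬ (s ≡ t) → χ s ≡ χ t → ¬ U (s · t)

U-set : ℤ → ℤ → ℤ × ℤ → Set
U-set a d x =
  (x ≡ (a , + 0)) ⊎ (x ≡ (+ 0 , + 0)) ⊎
  (InB x × (proj₂ x ≡ d) × ((proj₁ x ⊔ (proj₁ x + proj₂ x)) < a))

module Submission where

-- Colour an element (x , y) of the bicyclic semigroup
-- by its row y alone when y ≠ 0, and on row 0 by whether x = a.  A product
-- (p , q)(r , w) lies in row q + w, so a monochromatic product of distinct
-- elements can land in U only if
--   * both factors lie in row 0: then the product is (r ⊔ p , 0), which is
--     in U only when p = r, i.e. when the factors coincide;
--   * exactly one factor lies in row 0: then the other lies in row d and the
--     row-0 factor has column < a, so the two colours differ provided row d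
--     is coloured true;
--   * both rows are nonzero with sum 0 or d: excluded if the row colouring
--     separates such pairs.

open import Defs
open import Data.Integer using (ℤ; +_; _≤_; _<_)
open import Data.Integer as ℤ using (+[1+_]; -[1+_]; _⊔_; -_; _-_)
import Data.Integer.Properties as ℤ
open import Data.Integer.Tactic.RingSolver using (solve-∀)
open import Data.Nat as ℕ using (ℕ; zero; suc)
import Data.Nat.Properties as ℕ
open import Data.Nat.DivMod using (_%_; [m+n]%n≡m%n; m<n⇒m%n≡m)
open import Data.Bool using (Bool; true; false; not)
open import Data.Bool.Properties using (not-¬; not-involutive)
open import Data.Product using (Σ; _×_; _,_; proj₁; proj₂)
open import Data.Sum using (_⊎_; inj₁; inj₂)
open import Function using (_∘_)
open import Relation.Nullary using (¬_; Dec; yes; no; does; contradiction)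
open import Relation.Nullary.Decidable using (dec-true; dec-false)
open import Relation.Binary.PropositionalEquality

sub-add : ∀ x w → x - w ℤ.+ w ≡ x
sub-add = solve-∀

add-sub : ∀ x w → x ℤ.+ w - w ≡ x
add-sub = solve-∀

twice-plus-one : ∀ k → + 2 ℤ.* k ℤ.+ + 1 ≡ k ℤ.+ k ℤ.+ + 1
twice-plus-one = solve-∀

·-column : ∀ p q r w → proj₁ ((p , q) · (r , w)) ℤ.+ w ≡ (r ℤ.+ w) ⊔ p
·-column p q r w = sub-add ((r ℤ.+ w) ⊔ p) w

left-column≤ : ∀ p q r w → p ≤ proj₁ ((p , q) · (r , w)) ℤ.+ w
left-column≤ p q r w =
  ℤ.≤-trans (ℤ.i≤j⊔i (r ℤ.+ w) p) (ℤ.≤-reflexive (sym (·-column p q r w)))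

right-column≤ : ∀ p q r w → r ≤ proj₁ ((p , q) · (r , w))
right-column≤ p q r w =
  ℤ.≤-trans (ℤ.≤-reflexive (sym (add-sub r w))) (ℤ.+-monoˡ-≤ (- w) (ℤ.i≤i⊔j (r ℤ.+ w) p))

zeroRow-product : ∀ p r → (p , + 0) · (r , + 0) ≡ (r ⊔ p , + 0)
zeroRow-product p r =
  cong (_, + 0) (trans (ℤ.+-identityʳ _) (cong (_⊔ p) (ℤ.+-identityʳ r)))

Separates : (ℤ → Bool) → ℤ → Set
Separates τ c = ∀ y z → y ≢ + 0 → z ≢ + 0 → y ℤ.+ z ≡ c → τ y ≢ τ z

record RowColouring (d : ℤ) : Set where
  field
    rowColour   : ℤ → Bool
    separates-0 : Separates rowColour (+ 0)
    separates-d : Separates rowColour d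
    marks-d     : rowColour d ≡ true

decided : ∀ {A : Set} (a? : Dec A) → does a? ≡ true → A
decided (yes a) _ = a
decided (no _) ()

module _ (a : ℤ) {d : ℤ} (R : RowColouring d) (d≢0 : d ≢ + 0) where
  open RowColouring R

  colour : ℤ × ℤ → Bool
  colour (x , + zero)        = does (x ℤ.≟ a)
  colour (x , y@(+[1+ _ ]))  = rowColour y
  colour (x , y@(-[1+ _ ]))  = rowColour y

  colour-offRow : ∀ x y → y ≢ + 0 → colour (x , y) ≡ rowColour y
  colour-offRow x (+ zero)  y≢0 = contradiction refl y≢0
  colour-offRow x +[1+ _ ]  _   = refl
  colour-offRow x -[1+ _ ]  _   = refl

  colour-below : ∀ x → x < a → colour (x , + 0) ≡ false
  colour-below x x<a = dec-false (x ℤ.≟ a) (ℤ.<⇒≢ x<a)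

  U-row : ∀ x y → U-set a d (x , y) → y ≡ + 0 ⊎ y ≡ d
  U-row x y (inj₁ refl)                 = inj₁ refl
  U-row x y (inj₂ (inj₁ refl))          = inj₁ refl
  U-row x y (inj₂ (inj₂ (_ , y≡d , _))) = inj₂ y≡d

  U-offRow : ∀ x y → y ≢ + 0 → U-set a d (x , y) → y ≡ d × x < a × x ℤ.+ y < a
  U-offRow x y y≢0 (inj₁ refl)        = contradiction refl y≢0
  U-offRow x y y≢0 (inj₂ (inj₁ refl)) = contradiction refl y≢0
  U-offRow x y y≢0 (inj₂ (inj₂ (_ , y≡d , max<a))) =
    y≡d , ℤ.≤-<-trans (ℤ.i≤i⊔j x _) max<a , ℤ.≤-<-trans (ℤ.i≤j⊔i x _) max<a

  zeroRows : ∀ p r → + 0 ≤ p → + 0 ≤ r → colour (p , + 0) ≡ colour (r , + 0) →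
             U-set a d (r ⊔ p , + 0) → p ≡ r
  zeroRows p r _ _ same (inj₁ eq) with ℤ.⊔-sel r p
  ... | inj₁ r⊔p≡r = trans (decided (p ℤ.≟ a) (trans same (dec-true (r ℤ.≟ a) r≡a))) (sym r≡a)
    where
    r≡a : r ≡ a
    r≡a = trans (sym r⊔p≡r) (cong proj₁ eq)
  ... | inj₂ r⊔p≡p = trans p≡a (sym (decided (r ℤ.≟ a) (trans (sym same) (dec-true (p ℤ.≟ a) p≡a))))
    where
    p≡a : p ≡ a
    p≡a = trans (sym r⊔p≡p) (cong proj₁ eq)
  zeroRows p r 0≤p 0≤r _ (inj₂ (inj₁ eq)) =
    trans (ℤ.≤-antisym p≤0 0≤p) (sym (ℤ.≤-antisym r≤0 0≤r))
    where
    p≤0 : p ≤ + 0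
    p≤0 = subst (p ≤_) (cong proj₁ eq) (ℤ.i≤j⊔i r p)
    r≤0 : r ≤ + 0
    r≤0 = subst (r ≤_) (cong proj₁ eq) (ℤ.i≤i⊔j r p)
  zeroRows p r _ _ _ (inj₂ (inj₂ (_ , 0≡d , _))) = contradiction (sym 0≡d) d≢0

  colours-differ : ∀ x z → x < a → colour (x , + 0) ≢ colour (z , d)
  colours-differ x z x<a same = false≢true
    (trans (sym (colour-below x x<a)) (trans same (trans (colour-offRow z d d≢0) marks-d)))
    where
    false≢true : false ≢ true
    false≢true ()

  -- Left factor in row 0, right factor off row 0: the right factor is in
  -- row d and the left column is < a.
  leftZeroRow : ∀ p r w → w ≢ + 0 → colour (p , + 0) ≡ colour (r , w) →
                ¬ U-set a d ((p , + 0) · (r , w))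
  leftZeroRow p r w w≢0 same u =
    colours-differ p r p<a (subst (λ y → colour (p , + 0) ≡ colour (r , y)) w≡d same)
    where
    c : ℤ
    c = proj₁ ((p , + 0) · (r , w))
    row≡w : + 0 ℤ.+ w ≡ w
    row≡w = ℤ.+-identityˡ w
    offRow : + 0 ℤ.+ w ≡ d × c < a × c ℤ.+ (+ 0 ℤ.+ w) < a
    offRow = U-offRow c (+ 0 ℤ.+ w) (w≢0 ∘ trans (sym row≡w)) u
    w≡d : w ≡ d
    w≡d = trans (sym row≡w) (proj₁ offRow)
    p<a : p < a
    p<a = ℤ.≤-<-trans (left-column≤ p (+ 0) r w)
            (subst (λ y → c ℤ.+ y < a) row≡w (proj₂ (proj₂ offRow)))

  rightZeroRow : ∀ p q r → q ≢ + 0 → colour (p , q) ≡ colour (r , + 0) →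
                 ¬ U-set a d ((p , q) · (r , + 0))
  rightZeroRow p q r q≢0 same u =
    colours-differ r p r<a (sym (subst (λ y → colour (p , y) ≡ colour (r , + 0)) q≡d same))
    where
    c : ℤ
    c = proj₁ ((p , q) · (r , + 0))
    row≡q : q ℤ.+ + 0 ≡ q
    row≡q = ℤ.+-identityʳ q
    offRow : q ℤ.+ + 0 ≡ d × c < a × c ℤ.+ (q ℤ.+ + 0) < a
    offRow = U-offRow c (q ℤ.+ + 0) (q≢0 ∘ trans (sym row≡q)) u
    q≡d : q ≡ d
    q≡d = trans (sym row≡q) (proj₁ offRow)
    r<a : r < a
    r<a = ℤ.≤-<-trans (right-column≤ p q r (+ 0)) (proj₁ (proj₂ offRow))

  -- Both factors off row 0: their rows sum to 0 or d and are separated.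
  nonzeroRows : ∀ p q r w → q ≢ + 0 → w ≢ + 0 → colour (p , q) ≡ colour (r , w) →
                ¬ U-set a d ((p , q) · (r , w))
  nonzeroRows p q r w q≢0 w≢0 same u = separated (U-row _ (q ℤ.+ w) u) sameRow
    where
    sameRow : rowColour q ≡ rowColour w
    sameRow = trans (sym (colour-offRow p q q≢0)) (trans same (colour-offRow r w w≢0))
    separated : q ℤ.+ w ≡ + 0 ⊎ q ℤ.+ w ≡ d → rowColour q ≢ rowColour w
    separated (inj₁ sum≡0) = separates-0 q w q≢0 w≢0 sum≡0
    separated (inj₂ sum≡d) = separates-d q w q≢0 w≢0 sum≡d

  rowColouring⇒avoidable : Avoidable (U-set a d)
  rowColouring⇒avoidable = colour , avoids
    where
    avoids : ∀ s t → InB s → InB t → s ≢ t → colour s ≡ colour t → ¬ U-set a d (s · t)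
    avoids (p , q) (r , w) (0≤p , _) (0≤r , _) s≢t same u with q ℤ.≟ + 0 | w ℤ.≟ + 0
    ... | yes refl | yes refl = s≢t (cong (_, + 0)
          (zeroRows p r 0≤p 0≤r same (subst (U-set a d) (zeroRow-product p r) u)))
    ... | yes refl | no w≢0   = leftZeroRow p r w w≢0 same u
    ... | no q≢0   | yes refl = rightZeroRow p q r q≢0 same u
    ... | no q≢0   | no w≢0   = nonzeroRows p q r w q≢0 w≢0 same u

period : ℕ → ℕ
period e = suc (e ℕ.+ e)

upper : ℕ → ℕ → Bool
upper e n = does (e ℕ.≤? n % period e)

upper-periodic : ∀ e m → upper e (period e ℕ.+ m) ≡ upper e m
upper-periodic e m = cong (λ k → does (e ℕ.≤? k))
  (trans (cong (_% period e) (ℕ.+-comm (period e) m)) ([m+n]%n≡m%n m (period e)))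

upper-below : ∀ e n → n ℕ.< period e → upper e n ≡ does (e ℕ.≤? n)
upper-below e n n<D = cong (λ k → does (e ℕ.≤? k)) (m<n⇒m%n≡m n<D)

threshold-complement : ∀ e n m → n ℕ.+ suc m ≡ e ℕ.+ e →
                       (e≤n? : Dec (e ℕ.≤ n)) (e≤m? : Dec (e ℕ.≤ m)) → does e≤n? ≢ does e≤m?
threshold-complement e n m h (yes e≤n) (yes e≤m) _ = ℕ.<⇒≱ n+m<e+e (ℕ.+-mono-≤ e≤n e≤m)
  where
  n+m<e+e : n ℕ.+ m ℕ.< e ℕ.+ e
  n+m<e+e = subst (n ℕ.+ m ℕ.<_) h (ℕ.+-monoʳ-< n (ℕ.n<1+n m))
threshold-complement e n m h (no e≰n) (no e≰m) _ =
  ℕ.<-irrefl h (ℕ.+-mono-≤ (ℕ.≰⇒> e≰n) (ℕ.≰⇒> e≰m))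
threshold-complement e n m h (yes _) (no _) ()
threshold-complement e n m h (no _) (yes _) ()

upper-complement : ∀ e n m → suc n ℕ.+ suc m ≡ period e → upper e n ≢ upper e m
upper-complement e n m h same =
  threshold-complement e n m (ℕ.suc-injective h) (e ℕ.≤? n) (e ℕ.≤? m)
  (trans (sym (upper-below e n n<D)) (trans same (upper-below e m m<D)))
  where
  n<D : n ℕ.< period e
  n<D = subst (suc n ℕ.≤_) h (ℕ.m≤m+n (suc n) (suc m))
  m<D : m ℕ.< period e
  m<D = subst (suc m ℕ.≤_) h (ℕ.m≤n+m (suc m) (suc n))

σ : ℕ → ℤ → Bool
σ e (+ zero)  = false
σ e +[1+ n ]  = upper e n
σ e -[1+ n ]  = not (upper e n)

σ-antipodal : ∀ e y → y ≢ + 0 → σ e (- y) ≡ not (σ e y)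
σ-antipodal e (+ zero) y≢0 = contradiction refl y≢0
σ-antipodal e +[1+ n ] _   = refl
σ-antipodal e -[1+ n ] _   = sym (not-involutive _)

σ-separates-0 : ∀ e → Separates (σ e) (+ 0)
σ-separates-0 e y z y≢0 _ y+z≡0 same =
  not-¬ refl (trans same (trans (cong (σ e) z≡-y) (σ-antipodal e y y≢0)))
  where
  open ≡-Reasoning
  z≡-y : z ≡ - y
  z≡-y = begin
    z                ≡⟨ add-sub z y ⟨
    z ℤ.+ y - y      ≡⟨ cong (_- y) (trans (ℤ.+-comm z y) y+z≡0) ⟩
    + 0 - y          ≡⟨ ℤ.+-identityˡ (- y) ⟩
    - y              ∎

-- A positive and a negative row summing to 2e + 1 are congruent up to sign.
σ-wraps : ∀ e n m → +[1+ n ] ℤ.+ -[1+ m ] ≡ + period e → upper e n ≢ not (upper e m)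
σ-wraps e n m h = not-¬ (trans (cong (upper e) n≡D+m) (upper-periodic e m))
  where
  -- 1 + n = (2e + 1) - (-(1 + m)) = (2e + 1) + (1 + m)
  n≡D+m : n ≡ period e ℕ.+ m
  n≡D+m = ℕ.suc-injective (trans
    (ℤ.+-injective (trans (sym (add-sub +[1+ n ] -[1+ m ])) (cong (_- -[1+ m ]) h)))
    (ℕ.+-suc (period e) m))

σ-separates-period : ∀ e → Separates (σ e) (+ period e)
σ-separates-period e (+ zero) _        y≢0 _   _ = contradiction refl y≢0
σ-separates-period e _        (+ zero) _   z≢0 _ = contradiction refl z≢0
σ-separates-period e +[1+ n ] +[1+ m ] _   _   h = upper-complement e n m (ℤ.+-injective h)
σ-separates-period e +[1+ n ] -[1+ m ] _   _   h = σ-wraps e n m h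
σ-separates-period e -[1+ m ] +[1+ n ] _   _   h =
  σ-wraps e n m (trans (ℤ.+-comm +[1+ n ] -[1+ m ]) h) ∘ sym
σ-separates-period e -[1+ m ] -[1+ n ] _   _   ()

-- Row 2e + 1 = 1 + 2e is coloured true since 2e lies in the upper half.
σ-rowColouring : ∀ e → RowColouring (+ period e)
σ-rowColouring e = record
  { rowColour   = σ e
  ; separates-0 = σ-separates-0 e
  ; separates-d = σ-separates-period e
  ; marks-d     = trans (upper-below e (e ℕ.+ e) (ℕ.n<1+n _))
                        (dec-true (e ℕ.≤? e ℕ.+ e) (ℕ.m≤m+n e e))
  }

separates-neg : ∀ τ c → Separates τ c → Separates (τ ∘ -_) (- c)
separates-neg τ c sep y z y≢0 z≢0 y+z≡-c =
  sep (- y) (- z) (neg≢0 y≢0) (neg≢0 z≢0) (begin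
    - y ℤ.+ - z  ≡⟨ ℤ.neg-distrib-+ y z ⟨
    - (y ℤ.+ z)  ≡⟨ cong -_ y+z≡-c ⟩
    - - c        ≡⟨ ℤ.neg-involutive c ⟩
    c            ∎)
  where
  open ≡-Reasoning
  neg≢0 : ∀ {x} → x ≢ + 0 → - x ≢ + 0
  neg≢0 x≢0 = x≢0 ∘ ℤ.neg-injective

rowColouring-neg : ∀ {d} → RowColouring d → RowColouring (- d)
rowColouring-neg {d} R = record
  { rowColour   = rowColour ∘ -_
  ; separates-0 = separates-neg rowColour (+ 0) separates-0
  ; separates-d = separates-neg rowColour d separates-d
  ; marks-d     = trans (cong rowColour (ℤ.neg-involutive d)) marks-d
  }
  where open RowColouring R

odd-± : ∀ d → Odd d → Σ ℕ λ e → d ≡ + period e ⊎ d ≡ - + period e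
odd-± d (+ e , d≡2k+1) =
  e , inj₁ (trans d≡2k+1 (trans (twice-plus-one (+ e)) (cong +_ (ℕ.+-comm (e ℕ.+ e) 1))))
odd-± d (-[1+ e ] , d≡2k+1) = e , inj₂ (trans d≡2k+1 (twice-plus-one -[1+ e ]))

-- Every odd d has a row colouring (from σ, reflected if d < 0).
mainTheorem15 : (a d : ℤ) → + 1 ≤ a → Odd d → d < a → Avoidable (U-set a d)
mainTheorem15 a d _ odd _ with odd-± d odd
... | e , inj₁ refl = rowColouring⇒avoidable a (σ-rowColouring e) (λ ())
... | e , inj₂ refl = rowColouring⇒avoidable a (rowColouring-neg (σ-rowColouring e)) (λ ())
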